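{- Let $W$ be a word over a finite alphabet and let $W=U_1\cdots U_m$ be its decomposition into runs. Then $W$ is a shuffle square if and only if there exists an ordered graph $G$ (loops and multiple edges allowed) on the vertex set $\{u_1,\dots,u_m\}$, ordered $u_1<\dots<u_m$, such that: 1. whenever $u_i$ and $u_j$ are joined by an edge, the runs $U_i$ and $U_j$ consist of the same letter; 2. $\deg_G(u_i)=|U_i|$ for every $i$; 3. $G$ is nest-free. Moreover, if such a graph $G$ exists, then assigning, in every run $U_h$, the first $\deg^{(\rightarrow)}_G(u_h)$ positions to $X$ and the next $\deg^{(\leftarrow)}_G(u_h)$ positions to $Y$ yields subwords $X,Y$ of $W$ with disjoint supports covering all positions of $W$ and with $X=Y$.
   Context: A run of a word is a maximal block of consecutive equal letters; every word decomposes uniquely as a concatenation of its runs. A word $W$ is a shuffle square if its positions can be partitioned into the supports of two subsequences $X$, $Y$ that are equal as words. An ordered graph is a graph (here loops and parallel edges are allowed) whose vertex set is linearly ordered. A nest is a pair of vertex-disjoint edges $e,f$ (loops included, a loop at $x$ having $\min=\max=x$) with $\min e<\min f$ and $\max e>\max f$; $G$ is nest-free if it contains no nest. For a vertex $u$, the right degree $\deg^{(\rightarrow)}_G(u)$ is the number of edges going from $u$ to a vertex to its right and the left degree $\deg^{(\leftarrow)}_G(u)$ the number going to the left, where each loop at $u$ contributes $1$ to each; $\deg_G(u)=\deg^{(\rightarrow)}_G(u)+\deg^{(\leftarrow)}_G(u)$. -}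

module Defs where

open import Data.Nat using (ℕ; zero; suc; _+_; _<_)
open import Data.Fin using (Fin; _≤?_) renaming (_<_ to _<ᶠ_)
open import Data.Fin.Properties using () renaming (_≟_ to _≟ᶠ_)
open import Data.Bool using (Bool; true; false; if_then_else_)
open import Data.Bool.Properties using () renaming (_≟_ to _≟ᵇ_)
open import Data.List using (List; []; _∷_; length; filter; replicate; _++_; concatMap; allFin; lookup)
open import Data.List.Membership.Propositional using (_∈_)
open import Data.Product using (Σ; _×_; _,_; proj₁; proj₂)
open import Data.Empty using (⊥)
open import Relation.Nullary using (¬_; does)
open import Relation.Binary.PropositionalEquality using (_≡_; _≢_)

Word : ℕ → Set
Word k = List (Fin k)

-- Run decomposition: a run is recorded as (letter , length), length ≥ 1.
-- runs w lists the maximal blocks of equal consecutive letters, left to right.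

Run : ℕ → Set
Run k = Fin k × ℕ

private
  addLetter : ∀ {k} → Fin k → List (Run k) → List (Run k)
  addLetter a [] = (a , 1) ∷ []
  addLetter a ((b , n) ∷ rs) =
    if does (a ≟ᶠ b) then (b , suc n) ∷ rs else (a , 1) ∷ (b , n) ∷ rs

runs : ∀ {k} → Word k → List (Run k)
runs [] = []
runs (a ∷ w) = addLetter a (runs w)

nRuns : ∀ {k} → Word k → ℕ
nRuns w = length (runs w)

runLetter : ∀ {k} (w : Word k) → Fin (nRuns w) → Fin k
runLetter w i = proj₁ (lookup (runs w) i)

runLength : ∀ {k} (w : Word k) → Fin (nRuns w) → ℕ
runLength w i = proj₂ (lookup (runs w) i)

-- A partition of the positions of W into the supports
-- of X and Y is a colouring c (one Bool per position; true = X, false = Y).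
-- select w c b is the subsequence of w at the positions coloured b.

select : ∀ {k} → Word k → List Bool → Bool → Word k
select [] _ b = []
select (_ ∷ _) [] b = []
select (a ∷ w) (c ∷ cs) b =
  if does (c ≟ᵇ b) then a ∷ select w cs b else select w cs b

IsShuffleSquare : ∀ {k} → Word k → Set
IsShuffleSquare w =
  Σ (List Bool) λ c → (length c ≡ length w) × (select w c true ≡ select w c false)

-- An edge is an unordered pair given
-- as an ordered pair of endpoints (any order); the edge multiset is a list.

Edge : ℕ → Set
Edge m = Fin m × Fin m

Graph : ℕ → Set
Graph m = List (Edge m)

minE : ∀ {m} → Edge m → Fin m
minE (a , b) = if does (a ≤? b) then a else b

maxE : ∀ {m} → Edge m → Fin m
maxE (a , b) = if does (a ≤? b) then b else a

-- Right degree: an edge e counts for u iff it goes from u to a vertex to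
-- the right of u, or is a loop at u; i.e. iff u = min e.
-- Left degree: symmetric, iff u = max e.  (A loop counts once for each.)
rightDeg : ∀ {m} → Graph m → Fin m → ℕ
rightDeg E u = length (filter (λ e → minE e ≟ᶠ u) E)

leftDeg : ∀ {m} → Graph m → Fin m → ℕ
leftDeg E u = length (filter (λ e → maxE e ≟ᶠ u) E)

deg : ∀ {m} → Graph m → Fin m → ℕ
deg E u = rightDeg E u + leftDeg E u

Disjoint : ∀ {m} → Edge m → Edge m → Set
Disjoint (a , b) (c , d) = a ≢ c × a ≢ d × b ≢ c × b ≢ d

Nest : ∀ {m} → Edge m → Edge m → Set
Nest e f = Disjoint e f × (minE e <ᶠ minE f) × (maxE f <ᶠ maxE e)

NestFree : ∀ {m} → Graph m → Set
NestFree E = ∀ (i j : Fin (length E)) → ¬ Nest (lookup E i) (lookup E j)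

IsRunGraph : ∀ {k} (w : Word k) → Graph (nRuns w) → Set
IsRunGraph w E =
  (∀ {e} → e ∈ E → runLetter w (proj₁ e) ≡ runLetter w (proj₂ e))
  × (∀ u → deg E u ≡ runLength w u)
  × NestFree E

canonicalColouring : ∀ {k} (w : Word k) → Graph (nRuns w) → List Bool
canonicalColouring w E =
  concatMap (λ h → replicate (rightDeg E h) true ++ replicate (leftDeg E h) false)
            (allFin (nRuns w))

{-# OPTIONS --safe #-}
module Submission where

-- Replacing every letter of W by the index of its run turns the two halves X, Y of a shuffle
-- square into nondecreasing sequences of run indices; pairing their i-th entries gives a graph
-- whose edges increase in both coordinates along the pairing, hence contain no nest, and in
-- which run h has degree |U_h| because every position lies in exactly one of X, Y.
-- Conversely, list the edges of such a graph lexicographically by (left end, right end).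
-- Without nests the right ends are then nondecreasing as well, so the sorted left ends and the
-- sorted right ends are read off from the same edge list; they are the run indices of the
-- positions that the canonical colouring puts into X and into Y, and every edge joins runs of
-- the same letter, so X = Y.

open import Defs
open import Level using (Level)
open import Function using (id; _∘_)
open import Function.Bundles using (_⇔_; mk⇔)
open import Data.Nat using (ℕ; zero; suc; _+_; z<s; s<s)
import Data.Nat.Properties as ℕ
open import Data.Fin using (Fin; zero; suc; _≤_; _<_; _≤?_)
open import Data.Fin.Properties using (_≟_; suc-injective; ≤-reflexive; ≤∧≢⇒<; ≤-decTotalOrder)
open import Data.Bool using (Bool; true; false; if_then_else_)
open import Data.Bool.Properties using () renaming (_≟_ to _≟ᵇ_)
open import Data.Product using (_×_; _,_; proj₁; proj₂; ∃; uncurry)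
open import Data.Product.Relation.Binary.Pointwise.NonDependent using (Pointwise)
open import Data.Product.Relation.Binary.Lex.NonStrict using (×-decTotalOrder)
open import Data.Sum using (_⊎_; inj₁; inj₂; [_,_])
open import Data.List
  using (List; []; _∷_; _++_; length; map; zip; filter; replicate; concat; concatMap; tabulate; lookup)
open import Data.List.Properties
  using ( ∷-injectiveˡ; ∷-injectiveʳ; length-++; length-map; length-replicate; filter-++; concat-map
        ; map-∘; map-cong-local; map-replicate; map-tabulate; tabulate-cong; tabulate-lookup)
open import Data.List.Membership.Propositional using (_∈_)
open import Data.List.Membership.Propositional.Properties using (∈-lookup)
open import Data.List.Relation.Unary.Any using (here; there; index)
open import Data.List.Relation.Unary.Any.Properties using (lookup-index)
open import Data.List.Relation.Unary.All as All using (All; []; _∷_)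
import Data.List.Relation.Unary.All.Properties as All
open import Data.List.Relation.Unary.AllPairs as AllPairs using (AllPairs; []; _∷_)
import Data.List.Relation.Unary.AllPairs.Properties as AllPairs
open import Data.List.Relation.Unary.Sorted.TotalOrder.Properties using (Sorted⇒AllPairs)
open import Data.List.Relation.Binary.Sublist.Propositional using (_⊆_; []; _∷_; _∷ʳ_; minimum)
open import Data.List.Relation.Binary.Sublist.Propositional.Properties using (All-resp-⊆)
open import Data.List.Relation.Binary.Permutation.Propositional
  using (_↭_; ↭-refl; ↭-sym; ↭-trans; prep; swap; module PermutationReasoning)
open import Data.List.Relation.Binary.Permutation.Propositional.Properties using (shift; ∈-resp-↭; filter-↭; ↭-length)
import Data.List.Relation.Binary.Permutation.Propositional.Properties as ↭
open import Relation.Binary using (DecTotalOrder; Reflexive)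
import Relation.Binary.Construct.On as On
open import Relation.Nullary using (Dec; yes; no; does; ¬_; contradiction)
open import Relation.Binary.PropositionalEquality
  using (_≡_; _≢_; refl; sym; trans; cong; cong₂; subst₂; module ≡-Reasoning)

private
  variable
    a b ℓ : Level
    A : Set a
    B : Set b
    k m : ℕ

blocks : (Fin m → ℕ) → (Fin m → A) → List A
blocks n f = concat (tabulate (λ h → replicate (n h) (f h)))

map-blocks : (g : A → B) (n : Fin m → ℕ) (f : Fin m → A) → map g (blocks n f) ≡ blocks n (g ∘ f)
map-blocks {A = A} {m = m} g n f = begin
  map g (concat (tabulate block))        ≡⟨ concat-map (tabulate block) ⟨
  concat (map (map g) (tabulate block))  ≡⟨ cong concat (map-tabulate block (map g)) ⟩
  concat (tabulate (map g ∘ block))      ≡⟨ cong concat (tabulate-cong (λ h → map-replicate g (n h) (f h))) ⟩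
  blocks n (g ∘ f)                       ∎
  where
  open ≡-Reasoning
  block : Fin m → List A
  block h = replicate (n h) (f h)

blocks-cong : {n n′ : Fin m → ℕ} (f : Fin m → A) → (∀ h → n h ≡ n′ h) → blocks n f ≡ blocks n′ f
blocks-cong f n≗n′ = cong concat (tabulate-cong (λ h → cong (λ k → replicate k (f h)) (n≗n′ h)))

blocks-zero : (f : Fin m → A) → blocks (λ _ → 0) f ≡ []
blocks-zero {m = zero}  f = refl
blocks-zero {m = suc m} f = blocks-zero (f ∘ suc)

blocks-sorted : (n : Fin m → ℕ) → AllPairs _≤_ (blocks n id)
blocks-sorted n = AllPairs.concat⁺
  (All.tabulate⁺ (λ h → replicate-sorted (n h)))
  (AllPairs.tabulate⁺-< (λ i<j → All.replicate⁺ _ (All.replicate⁺ _ (ℕ.<⇒≤ i<j))))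
  where
  replicate-sorted : ∀ {h : Fin m} k → AllPairs _≤_ (replicate k h)
  replicate-sorted zero    = []
  replicate-sorted (suc k) = All.replicate⁺ k ℕ.≤-refl ∷ replicate-sorted k

blocks-uncons : (n n′ : Fin m → ℕ) (f : Fin m → A) (x : Fin m) → n x ≡ suc (n′ x) →
  (∀ h → h ≢ x → n h ≡ n′ h) → (∀ h → h < x → n′ h ≡ 0) → blocks n f ≡ f x ∷ blocks n′ f
blocks-uncons {m = suc m} n n′ f zero nx n≗n′ below rewrite nx =
  cong (λ rest → f zero ∷ replicate (n′ zero) (f zero) ++ rest)
       (blocks-cong (f ∘ suc) (λ h → n≗n′ (suc h) λ ()))
blocks-uncons {m = suc m} n n′ f (suc x) nx n≗n′ below
  rewrite n≗n′ zero (λ ()) | below zero z<s =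
  blocks-uncons (n ∘ suc) (n′ ∘ suc) (f ∘ suc) x nx
    (λ h h≢x → n≗n′ (suc h) (h≢x ∘ suc-injective)) (λ h h<x → below (suc h) (s<s h<x))

occurrences : Fin m → List (Fin m) → ℕ
occurrences h xs = length (filter (_≟ h) xs)

occurrences-++ : (h : Fin m) (xs ys : List (Fin m)) →
  occurrences h (xs ++ ys) ≡ occurrences h xs + occurrences h ys
occurrences-++ h xs ys = trans (cong length (filter-++ (_≟ h) xs ys)) (length-++ (filter (_≟ h) xs))

occurrences-↭ : (h : Fin m) {xs ys : List (Fin m)} → xs ↭ ys → occurrences h xs ≡ occurrences h ys
occurrences-↭ h xs↭ys = ↭-length (filter-↭ (_≟ h) xs↭ys)

length-filter-≟ : (k : A → Fin m) (h : Fin m) (xs : List A) →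
  length (filter (λ x → k x ≟ h) xs) ≡ occurrences h (map k xs)
length-filter-≟ k h []       = refl
length-filter-≟ k h (x ∷ xs) with k x ≟ h
... | yes _ = cong suc (length-filter-≟ k h xs)
... | no  _ = length-filter-≟ k h xs

occurrences-absent : (h : Fin m) {xs : List (Fin m)} → All (_≢ h) xs → occurrences h xs ≡ 0
occurrences-absent h {[]}     []            = refl
occurrences-absent h {x ∷ xs} (x≢h ∷ x∉xs) with x ≟ h
... | yes x≡h = contradiction x≡h x≢h
... | no  _   = occurrences-absent h x∉xs

occurrences-replicate : (h : Fin m) (k : ℕ) → occurrences h (replicate k h) ≡ k
occurrences-replicate h zero    = refl
occurrences-replicate h (suc k) with h ≟ h
... | yes _   = cong suc (occurrences-replicate h k)
... | no  h≢h = contradiction refl h≢h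

occurrences-map-suc : (h : Fin m) (xs : List (Fin m)) → occurrences (suc h) (map suc xs) ≡ occurrences h xs
occurrences-map-suc h []       = refl
occurrences-map-suc h (x ∷ xs) with x ≟ h
... | yes _ = cong suc (occurrences-map-suc h xs)
... | no  _ = occurrences-map-suc h xs

occurrences-head : (x : Fin m) (xs : List (Fin m)) → occurrences x (x ∷ xs) ≡ suc (occurrences x xs)
occurrences-head x xs with x ≟ x
... | yes _   = refl
... | no  x≢x = contradiction refl x≢x

occurrences-tail : {h x : Fin m} (xs : List (Fin m)) → h ≢ x → occurrences h (x ∷ xs) ≡ occurrences h xs
occurrences-tail {h = h} {x} xs h≢x with x ≟ h
... | yes x≡h = contradiction (sym x≡h) h≢x
... | no  _   = refl

occurrences-blocks : (n : Fin m → ℕ) (h : Fin m) → occurrences h (blocks n id) ≡ n h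
occurrences-blocks {m = suc m} n h = begin
  occurrences h (replicate (n zero) zero ++ blocks (n ∘ suc) suc)
    ≡⟨ occurrences-++ h (replicate (n zero) zero) (blocks (n ∘ suc) suc) ⟩
  occurrences h (replicate (n zero) zero) + occurrences h (blocks (n ∘ suc) suc)
    ≡⟨ cong (λ xs → occurrences h (replicate (n zero) zero) + occurrences h xs) (map-blocks suc (n ∘ suc) id) ⟨
  occurrences h (replicate (n zero) zero) + occurrences h (map suc (blocks (n ∘ suc) id))
    ≡⟨ by-vertex h ⟩
  n h ∎
  where
  open ≡-Reasoning
  by-vertex : ∀ h → occurrences h (replicate (n zero) zero) + occurrences h (map suc (blocks (n ∘ suc) id)) ≡ n h
  by-vertex zero = begin
    occurrences zero (replicate (n zero) zero) + occurrences zero (map suc (blocks (n ∘ suc) id))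
      ≡⟨ cong₂ _+_ (occurrences-replicate zero (n zero)) (occurrences-absent zero suc≢zero) ⟩
    n zero + 0
      ≡⟨ ℕ.+-identityʳ (n zero) ⟩
    n zero ∎
    where
    suc≢zero : All (_≢ zero) (map suc (blocks (n ∘ suc) id))
    suc≢zero = All.map⁺ (All.universal (λ _ ()) (blocks (n ∘ suc) id))
  by-vertex (suc h) = cong₂ _+_
    (occurrences-absent (suc h) (All.replicate⁺ (n zero) (λ ())))
    (trans (occurrences-map-suc h (blocks (n ∘ suc) id)) (occurrences-blocks (n ∘ suc) h))

blocks-occurrences : {xs : List (Fin m)} → AllPairs _≤_ xs → blocks (λ h → occurrences h xs) id ≡ xs
blocks-occurrences {xs = []}     []              = blocks-zero id
blocks-occurrences {xs = x ∷ xs} (x≤xs ∷ sorted) = begin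
  blocks (λ h → occurrences h (x ∷ xs)) id
    ≡⟨ blocks-uncons _ _ id x (occurrences-head x xs) (λ h → occurrences-tail xs) below-x ⟩
  x ∷ blocks (λ h → occurrences h xs) id
    ≡⟨ cong (x ∷_) (blocks-occurrences sorted) ⟩
  x ∷ xs ∎
  where
  open ≡-Reasoning
  below-x : ∀ h → h < x → occurrences h xs ≡ 0
  below-x h h<x = occurrences-absent h (All.map (λ { x≤h refl → ℕ.<⇒≱ h<x x≤h }) x≤xs)

expandRun : Run k → Word k
expandRun (x , n) = replicate n x

concatMap-expandRun-runs : (w : Word k) → concatMap expandRun (runs w) ≡ w
concatMap-expandRun-runs []      = refl
concatMap-expandRun-runs (x ∷ w) with runs w | concatMap-expandRun-runs w
... | []           | refl = refl
... | (y , n) ∷ rs | eq with x ≟ y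
...   | yes refl = cong (x ∷_) eq
...   | no  _    = cong (x ∷_) eq

word-as-blocks : (w : Word k) → blocks (runLength w) (runLetter w) ≡ w
word-as-blocks w = begin
  concat (tabulate (expandRun ∘ lookup (runs w)))        ≡⟨ cong concat (map-tabulate (lookup (runs w)) expandRun) ⟨
  concat (map expandRun (tabulate (lookup (runs w))))    ≡⟨ cong (concatMap expandRun) (tabulate-lookup (runs w)) ⟩
  concatMap expandRun (runs w)                           ≡⟨ concatMap-expandRun-runs w ⟩
  w                                                      ∎
  where open ≡-Reasoning

AllPairs-resp-⊆ : {R : A → A → Set ℓ} {xs ys : List A} → xs ⊆ ys → AllPairs R ys → AllPairs R xs
AllPairs-resp-⊆ []          []            = []
AllPairs-resp-⊆ (_ ∷ʳ xs⊆ys) (_ ∷ Rys)     = AllPairs-resp-⊆ xs⊆ys Rys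
AllPairs-resp-⊆ (refl ∷ xs⊆ys) (Ry ∷ Rys)  = All-resp-⊆ xs⊆ys Ry ∷ AllPairs-resp-⊆ xs⊆ys Rys

select-⊆ : (xs : Word k) (c : List Bool) (b : Bool) → select xs c b ⊆ xs
select-⊆ []       c        b = []
select-⊆ (x ∷ xs) []       b = minimum (x ∷ xs)
select-⊆ (x ∷ xs) (c ∷ cs) b with does (c ≟ᵇ b)
... | true  = refl ∷ select-⊆ xs cs b
... | false = x ∷ʳ select-⊆ xs cs b

select-map : ∀ {k′} (g : Fin k → Fin k′) (xs : Word k) (c : List Bool) (b : Bool) →
  select (map g xs) c b ≡ map g (select xs c b)
select-map g []       c        b = refl
select-map g (x ∷ xs) []       b = refl
select-map g (x ∷ xs) (c ∷ cs) b with does (c ≟ᵇ b)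
... | true  = cong (g x ∷_) (select-map g xs cs b)
... | false = select-map g xs cs b

select-↭ : (xs : Word k) (c : List Bool) → length c ≡ length xs → select xs c true ++ select xs c false ↭ xs
select-↭ []       []           _       = ↭-refl
select-↭ (x ∷ xs) (true  ∷ cs) |c|≡|xs| = prep x (select-↭ xs cs (ℕ.suc-injective |c|≡|xs|))
select-↭ (x ∷ xs) (false ∷ cs) |c|≡|xs| =
  ↭-trans (shift x (select xs cs true) (select xs cs false)) (prep x (select-↭ xs cs (ℕ.suc-injective |c|≡|xs|)))

select-++ : (xs ys : Word k) (cs ds : List Bool) (b : Bool) → length xs ≡ length cs →
  select (xs ++ ys) (cs ++ ds) b ≡ select xs cs b ++ select ys ds b
select-++ []       ys []       ds b _ = refl
select-++ (x ∷ xs) ys (c ∷ cs) ds b |xs|≡|cs| with does (c ≟ᵇ b)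
... | true  = cong (x ∷_) (select-++ xs ys cs ds b (ℕ.suc-injective |xs|≡|cs|))
... | false = select-++ xs ys cs ds b (ℕ.suc-injective |xs|≡|cs|)

select-concat-tabulate : (G : Fin m → Word k) (C : Fin m → List Bool) (b : Bool) →
  (∀ h → length (G h) ≡ length (C h)) →
  select (concat (tabulate G)) (concat (tabulate C)) b ≡ concat (tabulate (λ h → select (G h) (C h) b))
select-concat-tabulate {m = zero}  G C b _          = refl
select-concat-tabulate {m = suc m} G C b |G|≗|C| =
  trans (select-++ (G zero) _ (C zero) _ b (|G|≗|C| zero))
        (cong (select (G zero) (C zero) b ++_) (select-concat-tabulate (G ∘ suc) (C ∘ suc) b (|G|≗|C| ∘ suc)))

length-concat-tabulate : (G : Fin m → List A) (H : Fin m → List B) →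
  (∀ h → length (G h) ≡ length (H h)) → length (concat (tabulate G)) ≡ length (concat (tabulate H))
length-concat-tabulate {m = zero}  G H _       = refl
length-concat-tabulate {m = suc m} G H |G|≗|H| = begin
  length (G zero ++ concat (tabulate (G ∘ suc)))
    ≡⟨ length-++ (G zero) ⟩
  length (G zero) + length (concat (tabulate (G ∘ suc)))
    ≡⟨ cong₂ _+_ (|G|≗|H| zero) (length-concat-tabulate (G ∘ suc) (H ∘ suc) (|G|≗|H| ∘ suc)) ⟩
  length (H zero) + length (concat (tabulate (H ∘ suc)))
    ≡⟨ length-++ (H zero) ⟨
  length (H zero ++ concat (tabulate (H ∘ suc))) ∎
  where open ≡-Reasoning

splitColouring : (r l : Fin m → ℕ) → List Bool
splitColouring r l = concat (tabulate (λ h → replicate (r h) true ++ replicate (l h) false))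

canonicalColouring-split : (w : Word k) (E : Graph (nRuns w)) →
  canonicalColouring w E ≡ splitColouring (rightDeg E) (leftDeg E)
canonicalColouring-split w E =
  cong concat (map-tabulate id (λ h → replicate (rightDeg E h) true ++ replicate (leftDeg E h) false))

length-split-block : (r l : ℕ) (x : A) → length (replicate (r + l) x) ≡ length (replicate r true ++ replicate l false)
length-split-block r l x = begin
  length (replicate (r + l) x)                        ≡⟨ length-replicate (r + l) ⟩
  r + l                                               ≡⟨ cong₂ _+_ (length-replicate r) (length-replicate l) ⟨
  length (replicate r true) + length (replicate l false) ≡⟨ length-++ (replicate r true) ⟨
  length (replicate r true ++ replicate l false)      ∎
  where open ≡-Reasoning

length-splitColouring : (r l : Fin m → ℕ) (f : Fin m → A) →
  length (blocks (λ h → r h + l h) f) ≡ length (splitColouring r l)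
length-splitColouring r l f = length-concat-tabulate _ _ (λ h → length-split-block (r h) (l h) (f h))

select-replicate-split : (r l : ℕ) (x : Fin k) (b : Bool) →
  select (replicate (r + l) x) (replicate r true ++ replicate l false) b ≡ replicate (if b then r else l) x
select-replicate-split zero    zero    x true  = refl
select-replicate-split zero    zero    x false = refl
select-replicate-split zero    (suc l) x true  = select-replicate-split zero l x true
select-replicate-split zero    (suc l) x false = cong (x ∷_) (select-replicate-split zero l x false)
select-replicate-split (suc r) l       x true  = cong (x ∷_) (select-replicate-split r l x true)
select-replicate-split (suc r) l       x false = select-replicate-split r l x false

select-splitColouring : (r l : Fin m → ℕ) (f : Fin m → Fin k) (b : Bool) →
  select (blocks (λ h → r h + l h) f) (splitColouring r l) b ≡ blocks (λ h → if b then r h else l h) f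
select-splitColouring r l f b =
  trans (select-concat-tabulate _ _ b (λ h → length-split-block (r h) (l h) (f h)))
        (cong concat (tabulate-cong (λ h → select-replicate-split (r h) (l h) (f h) b)))

orientation : (e : Edge m) →
  (proj₁ e ≤ proj₂ e × minE e ≡ proj₁ e × maxE e ≡ proj₂ e) ⊎
  (proj₂ e < proj₁ e × minE e ≡ proj₂ e × maxE e ≡ proj₁ e)
orientation (x , y) = by-comparison (x ≤? y)
  where
  by-comparison : (x≤?y : Dec (x ≤ y)) →
    (x ≤ y × (if does x≤?y then x else y) ≡ x × (if does x≤?y then y else x) ≡ y) ⊎
    (y < x × (if does x≤?y then x else y) ≡ y × (if does x≤?y then y else x) ≡ x)
  by-comparison (yes x≤y) = inj₁ (x≤y , refl , refl)
  by-comparison (no  x≰y) = inj₂ (ℕ.≰⇒> x≰y , refl , refl)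

endpoints-↭ : (e : Edge m) → minE e ∷ maxE e ∷ [] ↭ proj₁ e ∷ proj₂ e ∷ []
endpoints-↭ e with orientation e
... | inj₁ (_ , min≡ , max≡) rewrite min≡ | max≡ = ↭-refl
... | inj₂ (_ , min≡ , max≡) rewrite min≡ | max≡ = swap (proj₂ e) (proj₁ e) ↭-refl

label-minE≡maxE : (f : Fin m → A) (e : Edge m) → f (proj₁ e) ≡ f (proj₂ e) → f (minE e) ≡ f (maxE e)
label-minE≡maxE f e f₁≡f₂ with orientation e
... | inj₁ (_ , min≡ , max≡) rewrite min≡ | max≡ = f₁≡f₂
... | inj₂ (_ , min≡ , max≡) rewrite min≡ | max≡ = sym f₁≡f₂

Extremal : Edge m → Fin m → Set
Extremal e x = x ≡ minE e ⊎ x ≡ maxE e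

Between : Edge m → Fin m → Set
Between e x = minE e ≤ x × x ≤ maxE e

endpoints-extremal : (e : Edge m) → Extremal e (proj₁ e) × Extremal e (proj₂ e)
endpoints-extremal e with orientation e
... | inj₁ (_ , min≡ , max≡) = inj₁ (sym min≡) , inj₂ (sym max≡)
... | inj₂ (_ , min≡ , max≡) = inj₂ (sym max≡) , inj₁ (sym min≡)

endpoints-between : (e : Edge m) → Between e (proj₁ e) × Between e (proj₂ e)
endpoints-between e with orientation e
... | inj₁ (x≤y , min≡ , max≡) rewrite min≡ | max≡ = (ℕ.≤-refl , x≤y) , (x≤y , ℕ.≤-refl)
... | inj₂ (y<x , min≡ , max≡) rewrite min≡ | max≡ = (ℕ.<⇒≤ y<x , ℕ.≤-refl) , (ℕ.≤-refl , ℕ.<⇒≤ y<x)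

nest-if-strictly-inside : (e g : Edge m) → minE e < minE g → maxE g < maxE e → Nest e g
nest-if-strictly-inside e g min< max< with endpoints-extremal e | endpoints-between g
... | e₁ , e₂ | g₁ , g₂ = (apart e₁ g₁ , apart e₁ g₂ , apart e₂ g₁ , apart e₂ g₂) , min< , max<
  where
  apart : ∀ {x y} → Extremal e x → Between g y → x ≢ y
  apart (inj₁ refl) (min≤y , _) refl = ℕ.<⇒≱ min< min≤y
  apart (inj₂ refl) (_ , y≤max) refl = ℕ.<⇒≱ max< y≤max

record Aligned (e g : Edge m) : Set where
  constructor aligned
  field
    minE≤ : minE e ≤ minE g
    maxE≤ : maxE e ≤ maxE g

aligned-¬nest : {e g : Edge m} → Aligned e g → ¬ Nest e g × ¬ Nest g e
aligned-¬nest (aligned min≤ max≤) =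
  (λ (_ , _ , max<) → ℕ.<⇒≱ max< max≤) , (λ (_ , min< , _) → ℕ.<⇒≱ min< min≤)

aligned-if-pointwise : {e g : Edge m} → Pointwise _≤_ _≤_ e g → Aligned e g
aligned-if-pointwise {e = e} {g} (x≤x′ , y≤y′) = uncurry aligned endpoints≤
  where
  endpoints≤ : minE e ≤ minE g × maxE e ≤ maxE g
  endpoints≤ with orientation e | orientation g
  ... | inj₁ (x≤y , e₁ , e₂) | inj₁ (_ , g₁ , g₂) rewrite e₁ | e₂ | g₁ | g₂ =
    x≤x′ , y≤y′
  ... | inj₁ (x≤y , e₁ , e₂) | inj₂ (y′<x′ , g₁ , g₂) rewrite e₁ | e₂ | g₁ | g₂ =
    ℕ.≤-trans x≤y y≤y′ , ℕ.<⇒≤ (ℕ.≤-<-trans y≤y′ y′<x′)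
  ... | inj₂ (y<x , e₁ , e₂) | inj₁ (x′≤y′ , g₁ , g₂) rewrite e₁ | e₂ | g₁ | g₂ =
    ℕ.<⇒≤ (ℕ.<-≤-trans y<x x≤x′) , ℕ.≤-trans x≤x′ x′≤y′
  ... | inj₂ (_ , e₁ , e₂) | inj₂ (_ , g₁ , g₂) rewrite e₁ | e₂ | g₁ | g₂ =
    y≤y′ , x≤x′

nestFree⁺ : {E : Graph m} → (∀ {e g} → e ∈ E → g ∈ E → ¬ Nest e g) → NestFree E
nestFree⁺ ¬nest i j = ¬nest (∈-lookup i) (∈-lookup j)

nestFree⁻ : {E : Graph m} → NestFree E → ∀ {e g} → e ∈ E → g ∈ E → ¬ Nest e g
nestFree⁻ nestFree e∈E g∈E nest =
  nestFree (index e∈E) (index g∈E) (subst₂ Nest (lookup-index e∈E) (lookup-index g∈E) nest)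

AllPairs-∈ : {R : A → A → Set ℓ} {xs : List A} → Reflexive R → AllPairs R xs →
  ∀ {x y} → x ∈ xs → y ∈ xs → R x y ⊎ R y x
AllPairs-∈ R-refl (_  ∷ _)   (here refl) (here refl) = inj₁ R-refl
AllPairs-∈ R-refl (Rx ∷ _)   (here refl) (there y∈)  = inj₁ (All.lookup Rx y∈)
AllPairs-∈ R-refl (Rx ∷ _)   (there x∈)  (here refl) = inj₂ (All.lookup Rx x∈)
AllPairs-∈ R-refl (_  ∷ Rxs) (there x∈)  (there y∈)  = AllPairs-∈ R-refl Rxs x∈ y∈

nestFree-if-aligned : {E : Graph m} → AllPairs Aligned E → NestFree E
nestFree-if-aligned pairwiseAligned = nestFree⁺ λ e∈E g∈E →
  [ proj₁ ∘ aligned-¬nest , proj₂ ∘ aligned-¬nest ] (AllPairs-∈ (aligned ℕ.≤-refl ℕ.≤-refl) pairwiseAligned e∈E g∈E)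

map-++-map-↭ : (f g f′ g′ : A → B) → (∀ x → f x ∷ g x ∷ [] ↭ f′ x ∷ g′ x ∷ []) →
  (xs : List A) → map f xs ++ map g xs ↭ map f′ xs ++ map g′ xs
map-++-map-↭ f g f′ g′ pair↭ []       = ↭-refl
map-++-map-↭ f g f′ g′ pair↭ (x ∷ xs) = begin
  f x ∷ map f xs ++ g x ∷ map g xs       ↭⟨ prep (f x) (shift (g x) (map f xs) (map g xs)) ⟩
  f x ∷ g x ∷ map f xs ++ map g xs       ↭⟨ ↭.++⁺ (pair↭ x) (map-++-map-↭ f g f′ g′ pair↭ xs) ⟩
  f′ x ∷ g′ x ∷ map f′ xs ++ map g′ xs   ↭⟨ prep (f′ x) (shift (g′ x) (map f′ xs) (map g′ xs)) ⟨
  f′ x ∷ map f′ xs ++ g′ x ∷ map g′ xs   ∎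
  where open PermutationReasoning

deg-endpoints : (E : Graph m) (u : Fin m) → deg E u ≡ occurrences u (map proj₁ E ++ map proj₂ E)
deg-endpoints E u = begin
  rightDeg E u + leftDeg E u
    ≡⟨ cong₂ _+_ (length-filter-≟ minE u E) (length-filter-≟ maxE u E) ⟩
  occurrences u (map minE E) + occurrences u (map maxE E)
    ≡⟨ occurrences-++ u (map minE E) (map maxE E) ⟨
  occurrences u (map minE E ++ map maxE E)
    ≡⟨ occurrences-↭ u (map-++-map-↭ minE maxE proj₁ proj₂ endpoints-↭ E) ⟩
  occurrences u (map proj₁ E ++ map proj₂ E) ∎
  where open ≡-Reasoning

All-zip : ∀ {p q} {P : A → Set p} {Q : B → Set q} {xs ys} → All P xs → All Q ys →
  All (λ xy → P (proj₁ xy) × Q (proj₂ xy)) (zip xs ys)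
All-zip []       _        = []
All-zip (_ ∷ _)  []       = []
All-zip (p ∷ ps) (q ∷ qs) = (p , q) ∷ All-zip ps qs

AllPairs-zip : ∀ {r s} {R : A → A → Set r} {S : B → B → Set s} {xs ys} →
  AllPairs R xs → AllPairs S ys → AllPairs (Pointwise R S) (zip xs ys)
AllPairs-zip []         _          = []
AllPairs-zip (_ ∷ _)    []         = []
AllPairs-zip (Rx ∷ Rxs) (Sy ∷ Sys) = All-zip Rx Sy ∷ AllPairs-zip Rxs Sys

map-proj₁-zip : {xs : List A} {ys : List B} → length xs ≡ length ys → map proj₁ (zip xs ys) ≡ xs
map-proj₁-zip {xs = []}     {[]}     _   = refl
map-proj₁-zip {xs = x ∷ xs} {_ ∷ ys} |xs|≡|ys| = cong (x ∷_) (map-proj₁-zip (ℕ.suc-injective |xs|≡|ys|))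

map-proj₂-zip : {xs : List A} {ys : List B} → length xs ≡ length ys → map proj₂ (zip xs ys) ≡ ys
map-proj₂-zip {xs = []}     {[]}     _   = refl
map-proj₂-zip {xs = _ ∷ xs} {y ∷ ys} |xs|≡|ys| = cong (y ∷_) (map-proj₂-zip (ℕ.suc-injective |xs|≡|ys|))

zip-∈-map≡ : (f : A → B) {xs ys : List A} → map f xs ≡ map f ys →
  ∀ {e} → e ∈ zip xs ys → f (proj₁ e) ≡ f (proj₂ e)
zip-∈-map≡ f {_ ∷ xs} {_ ∷ ys} fxs≡fys (here refl) = ∷-injectiveˡ fxs≡fys
zip-∈-map≡ f {_ ∷ xs} {_ ∷ ys} fxs≡fys (there e∈) = zip-∈-map≡ f (∷-injectiveʳ fxs≡fys) e∈

shuffleSquare⇒runGraph : (w : Word k) → IsShuffleSquare w → ∃ (IsRunGraph w)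
shuffleSquare⇒runGraph {k = k} w (c , |c|≡|w| , square) = zip X Y , zip-∈-map≡ f fX≡fY , degrees , nestFree
  where
  open ≡-Reasoning
  f : Fin (nRuns w) → Fin k
  f = runLetter w
  N : Fin (nRuns w) → ℕ
  N = runLength w
  indices X Y : List (Fin (nRuns w))
  indices = blocks N id
  X = select indices c true
  Y = select indices c false

  labels-indices : map f indices ≡ w
  labels-indices = trans (map-blocks f N id) (word-as-blocks w)

  select-labels : ∀ b → select w c b ≡ map f (select indices c b)
  select-labels b = trans (cong (λ v → select v c b) (sym labels-indices)) (select-map f indices c b)

  fX≡fY : map f X ≡ map f Y
  fX≡fY = trans (sym (select-labels true)) (trans square (select-labels false))

  |X|≡|Y| : length X ≡ length Y
  |X|≡|Y| = trans (sym (length-map f X)) (trans (cong length fX≡fY) (length-map f Y))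

  |c|≡|indices| : length c ≡ length indices
  |c|≡|indices| = trans |c|≡|w| (trans (cong length (sym labels-indices)) (length-map f indices))

  degrees : ∀ u → deg (zip X Y) u ≡ N u
  degrees u = begin
    deg (zip X Y) u
      ≡⟨ deg-endpoints (zip X Y) u ⟩
    occurrences u (map proj₁ (zip X Y) ++ map proj₂ (zip X Y))
      ≡⟨ cong₂ (λ xs ys → occurrences u (xs ++ ys)) (map-proj₁-zip {xs = X} |X|≡|Y|) (map-proj₂-zip {xs = X} |X|≡|Y|) ⟩
    occurrences u (X ++ Y)
      ≡⟨ occurrences-↭ u (select-↭ indices c |c|≡|indices|) ⟩
    occurrences u indices
      ≡⟨ occurrences-blocks N u ⟩
    N u ∎

  sorted : ∀ b → AllPairs _≤_ (select indices c b)
  sorted b = AllPairs-resp-⊆ (select-⊆ indices c b) (blocks-sorted N)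

  nestFree : NestFree (zip X Y)
  nestFree = nestFree-if-aligned (AllPairs.map aligned-if-pointwise (AllPairs-zip (sorted true) (sorted false)))

edgeOrder : (m : ℕ) → DecTotalOrder _ _ _
edgeOrder m = On.decTotalOrder (×-decTotalOrder (≤-decTotalOrder m) (≤-decTotalOrder m)) (λ e → minE e , maxE e)

module _ {m : ℕ} where
  open DecTotalOrder (edgeOrder m) using (totalOrder) renaming (_≤_ to _≤ₗₑₓ_)
  open import Data.List.Sort (edgeOrder m) using (sort; sort-↭; sort-↗)

  aligned-if-lex : {e g : Edge m} → e ≤ₗₑₓ g → ¬ Nest e g → Aligned e g
  aligned-if-lex (inj₂ (min≡ , max≤)) _ = aligned (≤-reflexive min≡) max≤
  aligned-if-lex {e} {g} (inj₁ (min≤ , min≢)) ¬nest with maxE e ≤? maxE g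
  ... | yes max≤ = aligned min≤ max≤
  ... | no  max≰ = contradiction (nest-if-strictly-inside e g (≤∧≢⇒< min≤ min≢) (ℕ.≰⇒> max≰)) ¬nest

  aligned-if-lexSorted : {E : Graph m} → (∀ {e g} → e ∈ E → g ∈ E → ¬ Nest e g) →
    AllPairs _≤ₗₑₓ_ E → AllPairs Aligned E
  aligned-if-lexSorted ¬nest []           = []
  aligned-if-lexSorted ¬nest (e≤E ∷ E↗) =
    All.tabulate (λ g∈E → aligned-if-lex (All.lookup e≤E g∈E) (¬nest (here refl) (there g∈E))) ∷
    aligned-if-lexSorted (λ e∈E g∈E → ¬nest (there e∈E) (there g∈E)) E↗

  blocks-count-sort : (k : Edge m → Fin m) (E : Graph m) → AllPairs _≤_ (map k (sort E)) →
    blocks (λ h → length (filter (λ e → k e ≟ h) E)) id ≡ map k (sort E)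
  blocks-count-sort k E k↗ = begin
    blocks (λ h → length (filter (λ e → k e ≟ h) E)) id
      ≡⟨ blocks-cong id (λ h → length-filter-≟ k h E) ⟩
    blocks (λ h → occurrences h (map k E)) id
      ≡⟨ blocks-cong id (λ h → occurrences-↭ h (↭.map⁺ k (↭-sym (sort-↭ E)))) ⟩
    blocks (λ h → occurrences h (map k (sort E))) id
      ≡⟨ blocks-occurrences k↗ ⟩
    map k (sort E) ∎
    where open ≡-Reasoning

  blocks-rightDeg≡blocks-leftDeg : (f : Fin m → A) (E : Graph m) →
    (∀ {e} → e ∈ E → f (proj₁ e) ≡ f (proj₂ e)) → NestFree E → blocks (rightDeg E) f ≡ blocks (leftDeg E) f
  blocks-rightDeg≡blocks-leftDeg f E labels nestFree = begin
    blocks (rightDeg E) f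
      ≡⟨ map-blocks f (rightDeg E) id ⟨
    map f (blocks (rightDeg E) id)
      ≡⟨ cong (map f) (blocks-count-sort minE E (AllPairs.map⁺ (AllPairs.map Aligned.minE≤ E′-aligned))) ⟩
    map f (map minE E′)
      ≡⟨ map-∘ E′ ⟨
    map (f ∘ minE) E′
      ≡⟨ map-cong-local (All.tabulate (λ {e} e∈E′ → label-minE≡maxE f e (labels (∈E e∈E′)))) ⟩
    map (f ∘ maxE) E′
      ≡⟨ map-∘ E′ ⟩
    map f (map maxE E′)
      ≡⟨ cong (map f) (blocks-count-sort maxE E (AllPairs.map⁺ (AllPairs.map Aligned.maxE≤ E′-aligned))) ⟨
    map f (blocks (leftDeg E) id)
      ≡⟨ map-blocks f (leftDeg E) id ⟩
    blocks (leftDeg E) f ∎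
    where
    open ≡-Reasoning
    E′ : Graph m
    E′ = sort E
    ∈E : ∀ {e} → e ∈ E′ → e ∈ E
    ∈E = ∈-resp-↭ (sort-↭ E)
    E′-aligned : AllPairs Aligned E′
    E′-aligned = aligned-if-lexSorted (λ e∈E′ g∈E′ → nestFree⁻ nestFree (∈E e∈E′) (∈E g∈E′))
                                      (Sorted⇒AllPairs totalOrder (sort-↗ E))

runGraph⇒canonicalColouring : (w : Word k) (E : Graph (nRuns w)) → IsRunGraph w E →
  (length (canonicalColouring w E) ≡ length w)
  × (select w (canonicalColouring w E) true ≡ select w (canonicalColouring w E) false)
runGraph⇒canonicalColouring {k = k} w E (labels , degrees , nestFree) = |c|≡|w| , square
  where
  open ≡-Reasoning
  r l : Fin (nRuns w) → ℕ
  r = rightDeg E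
  l = leftDeg E
  f : Fin (nRuns w) → Fin k
  f = runLetter w
  c : List Bool
  c = canonicalColouring w E

  w≡blocks : w ≡ blocks (λ h → r h + l h) f
  w≡blocks = trans (sym (word-as-blocks w)) (blocks-cong f (sym ∘ degrees))

  |c|≡|w| : length c ≡ length w
  |c|≡|w| = begin
    length c                             ≡⟨ cong length (canonicalColouring-split w E) ⟩
    length (splitColouring r l)          ≡⟨ length-splitColouring r l f ⟨
    length (blocks (λ h → r h + l h) f)  ≡⟨ cong length w≡blocks ⟨
    length w                             ∎

  select-c : ∀ b → select w c b ≡ blocks (λ h → if b then r h else l h) f
  select-c b = trans (cong₂ (λ v c → select v c b) w≡blocks (canonicalColouring-split w E))
                     (select-splitColouring r l f b)

  square : select w c true ≡ select w c false
  square = trans (select-c true)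
                 (trans (blocks-rightDeg≡blocks-leftDeg f E labels nestFree) (sym (select-c false)))

proposition2p1 : ∀ {k : ℕ} (w : Word k) →
    (IsShuffleSquare w ⇔ ∃ (λ E → IsRunGraph w E))
    × (∀ E → IsRunGraph w E →
         (length (canonicalColouring w E) ≡ length w)
         × (select w (canonicalColouring w E) true ≡ select w (canonicalColouring w E) false))
proposition2p1 w =
  mk⇔ (shuffleSquare⇒runGraph w)
      (λ (E , isRunGraph) → canonicalColouring w E , runGraph⇒canonicalColouring w E isRunGraph)
  , runGraph⇒canonicalColouring w
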